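{- Let $(D,r)$ be a connected rooted digraph. Then for any vertex $u\ne r$ that is not the head of a cut-edge, there exist two simple directed paths from $r$ to $u$ whose last arcs are different.
   Context: A rooted digraph $(D,r)$ is a finite digraph without loops or parallel arcs with a root $r$ of in-degree $0$; it is connected if every vertex is reachable from $r$. A cut-edge is an arc $e$ such that some vertex is unreachable from $r$ in $D-e$. -}

module Defs where

open import Data.Nat using (ℕ)
open import Data.Fin using (Fin)
open import Data.Fin.Properties using (_≟_)
open import Data.Product using (_×_; _,_; ∃-syntax; Σ-syntax)
open import Data.Product.Properties using (≡-dec)
open import Data.List using (List; []; _∷_; filter)
open import Data.List.Membership.Propositional using (_∈_)
open import Data.List.Relation.Unary.Unique.Propositional using (Unique)
open import Relation.Binary.PropositionalEquality using (_≡_)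
open import Relation.Nullary using (¬_)
open import Relation.Nullary.Decidable using (¬?)

-- An arc (tail , head) on vertex set Fin n.
Arc : ℕ → Set
Arc n = Fin n × Fin n

record Digraph (n : ℕ) : Set where
  field
    arcs     : List (Arc n)
    noLoops  : ∀ {x y} → (x , y) ∈ arcs → ¬ (x ≡ y)
    noParallel : Unique arcs
open Digraph public

RootHasInDeg0 : ∀ {n} → Digraph n → Fin n → Set
RootHasInDeg0 D r = ∀ x → ¬ ((x , r) ∈ arcs D)

data Reach {n : ℕ} (A : List (Arc n)) : Fin n → Fin n → Set where
  here  : ∀ {x} → Reach A x x
  there : ∀ {x y z} → (x , y) ∈ A → Reach A y z → Reach A x z

removeArc : ∀ {n} → Arc n → List (Arc n) → List (Arc n)
removeArc e A = filter (λ a → ¬? (≡-dec _≟_ _≟_ a e)) A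

Connected : ∀ {n} → Digraph n → Fin n → Set
Connected D r = ∀ v → Reach (arcs D) r v

IsCutEdge : ∀ {n} → Digraph n → Fin n → Arc n → Set
IsCutEdge D r e = e ∈ arcs D × ∃[ v ] ¬ Reach (removeArc e (arcs D)) r v

data Walk {n : ℕ} (A : List (Arc n)) : Fin n → Fin n → Set where
  [_]  : ∀ x → Walk A x x
  _∷⟨_⟩_ : ∀ x {y z} → (x , y) ∈ A → Walk A y z → Walk A x z

vertices : ∀ {n} {A : List (Arc n)} {x y} → Walk A x y → List (Fin n)
vertices [ x ] = x ∷ []
vertices (x ∷⟨ _ ⟩ w) = x ∷ vertices w

record SimplePath {n : ℕ} (A : List (Arc n)) (x y : Fin n) : Set where
  constructor path
  field
    walk   : Walk A x y
    simple : Unique (vertices walk)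
open SimplePath public

data LastArc {n : ℕ} {A : List (Arc n)} : ∀ {x y} → Walk A x y → Arc n → Set where
  last-one  : ∀ {x y} (p : (x , y) ∈ A) → LastArc (x ∷⟨ p ⟩ [ y ]) (x , y)
  last-more : ∀ {x y z e} (p : (x , y) ∈ A) (w : Walk A y z) →
              LastArc w e → LastArc (x ∷⟨ p ⟩ w) e

module Submission where

-- Since u is reachable from r and u ≠ r, a walk r ⇝ u shortcut to a
-- simple path P ends with some arc (x , u).  That arc is not a cut-edge, so
-- every vertex, in particular u, is still reachable from r in D - (x , u);
-- shortcutting such a walk gives a simple path Q of D - (x , u) whose last arc
-- (y , u) differs from (x , u), and Q is also a simple path of D.

open import Defs
open import Data.Nat using (ℕ; zero; suc; _≤_; z≤n; s≤s)
open import Data.Fin using (Fin)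
open import Data.Fin.Properties using (_≟_; injective⇒≤)
open import Data.Product using (_×_; _,_; ∃-syntax; Σ-syntax; proj₁; proj₂)
open import Data.Product.Properties using (≡-dec)
open import Data.List using (List; []; _∷_; length; lookup)
open import Data.List.Membership.Propositional using (_∈_; find; lose)
open import Data.List.Membership.Propositional.Properties using (∈-filter⁻; ∈-lookup)
open import Data.List.Membership.DecPropositional using (_∈?_)
open import Data.List.Relation.Binary.Subset.Propositional using (_⊆_)
open import Data.List.Relation.Unary.Any using (here; there; any?)
open import Data.List.Relation.Unary.All.Properties using (¬Any⇒All¬)
import Data.List.Relation.Unary.All as All
open import Data.List.Relation.Unary.Unique.Propositional using (Unique)
open import Data.List.Relation.Unary.AllPairs using ([]; _∷_)
open import Data.Empty using (⊥-elim)
open import Function using (id)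
open import Relation.Binary.PropositionalEquality using (_≡_; _≢_; refl; sym; cong; subst; ≢-sym)
open import Relation.Nullary using (¬_; Dec; yes; no)
open import Relation.Nullary.Decidable using (¬?; _×-dec_)

private
  variable
    n : ℕ
    A B : List (Arc n)
    x y z : Fin n

-- A list without repetitions of elements of Fin n has at most n entries,
-- because indexing into it is injective.
unique-lookup-injective : (xs : List (Fin n)) → Unique xs →
  ∀ i j → lookup xs i ≡ lookup xs j → i ≡ j
unique-lookup-injective (_ ∷ _) _ Fin.zero Fin.zero _ = refl
unique-lookup-injective (_ ∷ _) (x∉ ∷ _) Fin.zero (Fin.suc j) eq =
  ⊥-elim (All.lookup x∉ (∈-lookup j) eq)
unique-lookup-injective (_ ∷ _) (x∉ ∷ _) (Fin.suc i) Fin.zero eq =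
  ⊥-elim (All.lookup x∉ (∈-lookup i) (sym eq))
unique-lookup-injective (_ ∷ xs) (_ ∷ u) (Fin.suc i) (Fin.suc j) eq =
  cong Fin.suc (unique-lookup-injective xs u i j eq)

unique-length : (xs : List (Fin n)) → Unique xs → length xs ≤ n
unique-length xs u = injective⇒≤ (unique-lookup-injective xs u _ _)

toWalk : Reach A x y → Walk A x y
toWalk {x = x} here = [ x ]
toWalk {x = x} (there a r) = x ∷⟨ a ⟩ toWalk r

toReach : Walk A x y → Reach A x y
toReach [ _ ] = here
toReach (_ ∷⟨ a ⟩ w) = there a (toReach w)

mapWalk : A ⊆ B → Walk A x y → Walk B x y
mapWalk A⊆B [ x ] = [ x ]
mapWalk A⊆B (x ∷⟨ a ⟩ w) = x ∷⟨ A⊆B a ⟩ mapWalk A⊆B w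

vertices-mapWalk : (A⊆B : A ⊆ B) (w : Walk A x y) → vertices (mapWalk A⊆B w) ≡ vertices w
vertices-mapWalk A⊆B [ x ] = refl
vertices-mapWalk A⊆B (x ∷⟨ a ⟩ w) = cong (x ∷_) (vertices-mapWalk A⊆B w)

lastArc-mapWalk : ∀ {e} (A⊆B : A ⊆ B) {w : Walk A x y} → LastArc w e → LastArc (mapWalk A⊆B w) e
lastArc-mapWalk A⊆B (last-one a) = last-one (A⊆B a)
lastArc-mapWalk A⊆B (last-more a w l) = last-more (A⊆B a) (mapWalk A⊆B w) (lastArc-mapWalk A⊆B l)

mapPath : A ⊆ B → SimplePath A x y → SimplePath B x y
mapPath A⊆B (path w simple) =
  path (mapWalk A⊆B w) (subst Unique (sym (vertices-mapWalk A⊆B w)) simple)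

lastArc : (a : (x , y) ∈ A) (w : Walk A y z) → ∃[ t ] ((t , z) ∈ A × LastArc (x ∷⟨ a ⟩ w) (t , z))
lastArc a [ _ ] = _ , a , last-one a
lastArc a (_ ∷⟨ b ⟩ w) with lastArc b w
... | t , c , l = t , c , last-more a _ l

suffixFrom : (w : Walk A y z) → x ∈ vertices w →
  Σ[ w′ ∈ Walk A x z ] (Unique (vertices w) → Unique (vertices w′))
suffixFrom [ y ] (here refl) = [ y ] , id
suffixFrom w@(_ ∷⟨ _ ⟩ _) (here refl) = w , id
suffixFrom (_ ∷⟨ _ ⟩ w) (there x∈w) with suffixFrom w x∈w
... | w′ , simple = w′ , λ { (_ ∷ u) → simple u }

-- Inductively, the shortcut tail either avoids the first vertex (keep
-- the first arc) or passes through it (keep only the tail from there on).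
shortcut : Walk A x y → Σ[ w ∈ Walk A x y ] Unique (vertices w)
shortcut [ x ] = [ x ] , (All.[] ∷ [])
shortcut (x ∷⟨ a ⟩ w) with shortcut w
... | w′ , u with _∈?_ _≟_ x (vertices w′)
...   | yes x∈w′ with suffixFrom w′ x∈w′
...     | w″ , simple = w″ , simple u
shortcut (x ∷⟨ a ⟩ w) | w′ , u | no x∉w′ = (x ∷⟨ a ⟩ w′) , (¬Any⇒All¬ _ x∉w′ ∷ u)

simplePathWithLastArc : x ≢ y → Reach A x y →
  Σ[ P ∈ SimplePath A x y ] ∃[ t ] ((t , y) ∈ A × LastArc (walk P) (t , y))
simplePathWithLastArc x≢y r with shortcut (toWalk r)
... | [ _ ] , _ = ⊥-elim (x≢y refl)
... | w@(_ ∷⟨ a ⟩ w′) , u = path w u , lastArc a w′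

-- Reachability is decidable.  Walks with at most k vertices are searched by
-- recursion on k; since shortcut walks have at most n vertices, k = n suffices.
decBoundedWalk : (A : List (Arc n)) (k : ℕ) (x y : Fin n) →
  Dec (Σ[ w ∈ Walk A x y ] length (vertices w) ≤ k)
decBoundedWalk A zero x y = no λ { ([ _ ] , ()) ; ((_ ∷⟨ _ ⟩ _) , ()) }
decBoundedWalk A (suc k) x y with x ≟ y
... | yes refl = yes ([ x ] , s≤s z≤n)
... | no x≢y with any? (λ a → (proj₁ a ≟ x) ×-dec decBoundedWalk A k (proj₂ a) y) A
...   | yes found with find found
...     | _ , a , refl , w , size = yes ((x ∷⟨ a ⟩ w) , s≤s size)
decBoundedWalk A (suc k) x y | no x≢y | no none =
  no λ { ([ _ ] , _) → x≢y refl
       ; ((_ ∷⟨ a ⟩ w) , s≤s size) → none (lose a (refl , w , size)) }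

decReach : (A : List (Arc n)) (x y : Fin n) → Dec (Reach A x y)
decReach {n} A x y with decBoundedWalk A n x y
... | yes (w , _) = yes (toReach w)
... | no none = no λ r → let w , u = shortcut (toWalk r) in none (w , unique-length _ u)

removeArc-⊆ : (e : Arc n) (A : List (Arc n)) → removeArc e A ⊆ A
removeArc-⊆ e A a∈ = proj₁ (∈-filter⁻ (λ b → ¬? (≡-dec _≟_ _≟_ b e)) {xs = A} a∈)

removeArc-≢ : (e : Arc n) (A : List (Arc n)) {a : Arc n} → a ∈ removeArc e A → a ≢ e
removeArc-≢ e A a∈ = proj₂ (∈-filter⁻ (λ b → ¬? (≡-dec _≟_ _≟_ b e)) {xs = A} a∈)

-- An arc of D that is not a cut-edge leaves every vertex reachable from r.
-- (Decidability turns the double negation into an actual walk.)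
notCut⇒reach : (D : Digraph n) (r : Fin n) {e : Arc n} → e ∈ arcs D → ¬ IsCutEdge D r e →
  ∀ v → Reach (removeArc e (arcs D)) r v
notCut⇒reach D r {e} e∈D notCut v with decReach (removeArc e (arcs D)) r v
... | yes reach = reach
... | no unreachable = ⊥-elim (notCut (e∈D , v , unreachable))

lemma24 : ∀ {n} (D : Digraph n) (r : Fin n) → RootHasInDeg0 D r → Connected D r →
    (u : Fin n) → ¬ (u ≡ r) → (∀ x → ¬ IsCutEdge D r (x , u)) →
    Σ[ P ∈ SimplePath (arcs D) r u ] Σ[ Q ∈ SimplePath (arcs D) r u ]
      ∃[ e ] ∃[ f ] (LastArc (walk P) e × LastArc (walk Q) f × ¬ (e ≡ f))
lemma24 D r _ connected u u≢r noCutInto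
  with simplePathWithLastArc (≢-sym u≢r) (connected u)
... | P , x , xu∈D , lastP
  with simplePathWithLastArc (≢-sym u≢r) (notCut⇒reach D r xu∈D (noCutInto x) u)
... | Q , y , yu∈D-xu , lastQ =
  P , mapPath D-xu⊆D Q , (x , u) , (y , u) , lastP , lastArc-mapWalk D-xu⊆D lastQ ,
  ≢-sym (removeArc-≢ (x , u) (arcs D) yu∈D-xu)
  where
  D-xu⊆D : removeArc (x , u) (arcs D) ⊆ arcs D
  D-xu⊆D = removeArc-⊆ (x , u) (arcs D)
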